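{- Let $G=(V,E)$ be an undirected or acyclic directed graph, $e\in E$ an edge, and $u,v\in V$ nodes such that there is a path from $u$ to $v$ in $G'=(V,E\setminus\{e\})$. Then for every shortest path $u=w_0,w_1,\dots,w_{d-1},w_d=v$ from $u$ to $v$ in $G'$ there is an edge $(w_i,w_{i+1})$ on it such that no shortest path from $u$ to $w_i$ in $G$ and no shortest path from $w_{i+1}$ to $v$ in $G$ uses $e$. -}

module Defs where

open import Data.Nat using (ℕ; zero; suc; _≤_; _≥_)
open import Data.Fin using (Fin; zero; suc; fromℕ; inject₁)
open import Data.Bool using (Bool; T)
open import Data.Product using (_×_; ∃-syntax)
open import Data.Sum using (_⊎_)
open import Relation.Nullary using (¬_)
open import Relation.Binary.PropositionalEquality using (_≡_)
open import Function.Definitions using (Injective)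

record Graph (n : ℕ) : Set where
  field
    adj : Fin n → Fin n → Bool

open Graph public

Edge : ∀ {n} → Graph n → Fin n → Fin n → Set
Edge G x y = T (adj G x y)

-- Walks written as vertex sequences w₀ , … , w_d (d = len),
-- with consecutive vertices related by R.
record Walk {n : ℕ} (R : Fin n → Fin n → Set) (u v : Fin n) : Set where
  field
    len   : ℕ
    vtx   : Fin (suc len) → Fin n
    start : vtx zero ≡ u
    end   : vtx (fromℕ len) ≡ v
    steps : (i : Fin len) → R (vtx (inject₁ i)) (vtx (suc i))

open Walk public

record Path {n : ℕ} (R : Fin n → Fin n → Set) (u v : Fin n) : Set where
  field
    walk   : Walk R u v
    simple : Injective _≡_ _≡_ (vtx walk)

open Path public

plen : ∀ {n} {R : Fin n → Fin n → Set} {u v : Fin n} → Path R u v → ℕ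
plen p = len (walk p)

pvtx : ∀ {n} {R : Fin n → Fin n → Set} {u v : Fin n} (p : Path R u v) → Fin (suc (plen p)) → Fin n
pvtx p = vtx (walk p)

Shortest : ∀ {n} {R : Fin n → Fin n → Set} {u v : Fin n} → Path R u v → Set
Shortest {R = R} {u} {v} p = (q : Path R u v) → plen p ≤ plen q

Undirected : ∀ {n} → Graph n → Set
Undirected G = ∀ x y → adj G x y ≡ adj G y x

Acyclic : ∀ {n} → Graph n → Set
Acyclic G = ∀ x (c : Walk (Edge G) x x) → len c ≡ 0

data Kind : Set where
  undirected directed : Kind

GraphOfKind : ∀ {n} → Kind → Graph n → Set
GraphOfKind undirected G = Undirected G
GraphOfKind directed   G = Acyclic G

Traverses : ∀ {n} → Kind → Fin n → Fin n → Fin n → Fin n → Set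
Traverses undirected a b x y = (x ≡ a × y ≡ b) ⊎ (x ≡ b × y ≡ a)
Traverses directed   a b x y = x ≡ a × y ≡ b

Minus : ∀ {n} → Kind → Graph n → Fin n → Fin n → Fin n → Fin n → Set
Minus k G a b x y = Edge G x y × ¬ Traverses k a b x y

Uses : ∀ {n} {R : Fin n → Fin n → Set} {u v : Fin n} →
       Kind → Fin n → Fin n → Path R u v → Set
Uses k a b p = ∃[ i ] Traverses k a b (pvtx p (inject₁ i)) (pvtx p (suc i))

-- Call a position j of p in-bad if a shortest G-path from u to p_j uses e, and out-bad if a
-- shortest G-path from p_j to v does. Position 0 is not in-bad, position d is not out-bad and
-- out-badness is decidable, so if no position is both there are consecutive positions i, i + 1
-- with i not in-bad and i + 1 not out-bad. A position that is both yields G-geodesics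
-- u ⇝ p_j ⇝ v through e of total length at most d = dist_G'(u, v), which is impossible: in an
-- acyclic graph they close a cycle through e; in an undirected one they use e either in the
-- same direction, and then minimality forces each one's segment between e and p_j to be
-- strictly shorter than the other's, or in opposite directions, and then their e-free ends
-- form a u-v walk in G' shorter than d.
module Submission where

open import Defs
open import Level using (0ℓ)
open import Data.Nat using (ℕ; zero; suc; _+_; _∸_; _≤_; _<_; z≤n; s≤s; s≤s⁻¹)
open import Data.Nat.Properties hiding (_≟_)
open import Data.Nat.Induction using (<-rec)
open import Data.Fin using (Fin; zero; suc; inject₁; fromℕ; toℕ; _≟_)
open import Data.Fin.Properties using (toℕ-fromℕ; toℕ-injective; toℕ<n; any?)
open import Data.Bool using (T)
open import Data.Product using (_×_; _,_; proj₁; ∃-syntax)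
open import Data.Sum using (_⊎_; inj₁; inj₂)
open import Data.Empty using (⊥; ⊥-elim)
open import Function using (_∘_)
open import Relation.Binary.Core using (Rel)
open import Relation.Binary.Definitions using (Decidable; Symmetric; tri<; tri≈; tri>)
open import Relation.Nullary using (¬_; Dec; yes; no)
open import Relation.Nullary.Decidable using (_×-dec_; _⊎-dec_; ¬?; T?; map′)
open import Relation.Binary.PropositionalEquality

private
  variable
    n k l m ℓ : ℕ
    x y z : Fin n
    R S : Rel (Fin n) 0ℓ

least : {P : ℕ → Set} → (∀ k → Dec (P k)) → P k →
        ∃[ m ] P m × (∀ {k′} → P k′ → m ≤ k′)
least {P = P} P? = <-rec (λ k → P k → Least) step _
  where
  Least : Set
  Least = ∃[ m ] P m × (∀ {k′} → P k′ → m ≤ k′)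
  step : ∀ k → (∀ {j} → j < k → P j → Least) → P k → Least
  step k rec Pk with anyUpTo? P? k
  ... | yes (j , j<k , Pj) = rec j<k Pj
  ... | no ¬smaller = k , Pk , λ Pk′ → ≮⇒≥ (λ k′<k → ¬smaller (_ , k′<k , Pk′))

crossover : ∀ {d} (A B : Fin (suc d) → Set) → (∀ j → Dec (B j)) →
            ¬ A zero → ¬ B (fromℕ d) → (∀ j → A j → B j → ⊥) → d ≢ 0 →
            ∃[ i ] ¬ A (inject₁ i) × ¬ B (suc i)
crossover {zero}  _ _ _ _ _ _ d≢0 = ⊥-elim (d≢0 refl)
crossover {suc d} A B B? ¬A₀ ¬Bd disjoint _ with B? (suc zero)
... | no ¬B₁ = zero , ¬A₀ , ¬B₁
... | yes B₁ with crossover (A ∘ suc) (B ∘ suc) (B? ∘ suc) (λ A₁ → disjoint _ A₁ B₁) ¬Bd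
                            (disjoint ∘ suc) (λ { refl → ¬Bd B₁ })
...   | i , ¬Ai , ¬Bi+1 = suc i , ¬Ai , ¬Bi+1

infixr 5 _∷_ _++_

data LWalk {n} (R : Rel (Fin n) 0ℓ) : ℕ → Fin n → Fin n → Set where
  []  : LWalk R 0 x x
  _∷_ : R x y → LWalk R k y z → LWalk R (suc k) x z

_++_ : LWalk R k x y → LWalk R l y z → LWalk R (k + l) x z
[]      ++ w = w
(r ∷ v) ++ w = r ∷ (v ++ w)

_∷ʳ_ : LWalk R k x y → R y z → LWalk R (suc k) x z
[]      ∷ʳ r = r ∷ []
(r′ ∷ w) ∷ʳ r = r′ ∷ (w ∷ʳ r)

reverse : Symmetric R → LWalk R k x y → LWalk R k y x
reverse sym []      = []
reverse sym (r ∷ w) = reverse sym w ∷ʳ sym r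

map : (∀ {x y} → R x y → S x y) → LWalk R k x y → LWalk S k x y
map f []      = []
map f (r ∷ w) = f r ∷ map f w

lwalk₀⇒≡ : LWalk R 0 x y → x ≡ y
lwalk₀⇒≡ [] = refl

lwalk? : Decidable R → ∀ k x y → Dec (LWalk R k x y)
lwalk? R? zero x y with x ≟ y
... | yes refl = yes []
... | no x≢y   = no λ { [] → x≢y refl }
lwalk? R? (suc k) x y with any? (λ z → R? x z ×-dec lwalk? R? k z y)
... | yes (z , r , w) = yes (r ∷ w)
... | no ¬step        = no λ { (r ∷ w) → ¬step (_ , r , w) }

≤Dist : Rel (Fin n) 0ℓ → ℕ → Fin n → Fin n → Set
≤Dist R m x y = ∀ {k} → LWalk R k x y → m ≤ k

Linked : Rel (Fin n) 0ℓ → ∀ L → (Fin (suc L) → Fin n) → Set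
Linked R L f = (i : Fin L) → R (f (inject₁ i)) (f (suc i))

prefixᶠ : ∀ {L} f → Linked R L f → (j : Fin (suc L)) → LWalk R (toℕ j) (f zero) (f j)
prefixᶠ             f s zero    = []
prefixᶠ {L = suc L} f s (suc j) = s zero ∷ prefixᶠ (f ∘ suc) (s ∘ suc) j

suffixᶠ : ∀ {L} f → Linked R L f → (j : Fin (suc L)) → LWalk R (L ∸ toℕ j) (f j) (f (fromℕ L))
suffixᶠ {L = zero}  f s zero    = []
suffixᶠ {L = suc L} f s zero    = s zero ∷ suffixᶠ (f ∘ suc) (s ∘ suc) zero
suffixᶠ {L = suc L} f s (suc j) = suffixᶠ (f ∘ suc) (s ∘ suc) j

prefix : (w : Walk R x y) (j : Fin (suc (len w))) → LWalk R (toℕ j) x (vtx w j)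
prefix {R = R} w j =
  subst (λ x → LWalk R (toℕ j) x (vtx w j)) (start w) (prefixᶠ (vtx w) (steps w) j)

suffix : (w : Walk R x y) (j : Fin (suc (len w))) → LWalk R (len w ∸ toℕ j) (vtx w j) y
suffix {R = R} w j = subst (LWalk R _ (vtx w j)) (end w) (suffixᶠ (vtx w) (steps w) j)

distinct⇒len≢0 : x ≢ y → (w : Walk R x y) → len w ≢ 0
distinct⇒len≢0 {y = y} {R = R} x≢y w len≡0 =
  x≢y (trans (sym (start w))
             (lwalk₀⇒≡ (subst (λ k → LWalk R k (vtx w zero) y) len≡0 (suffix w zero))))

vertex : {R : Rel (Fin n) 0ℓ} {x y : Fin n} → LWalk R k x y → Fin (suc k) → Fin n
vertex {x = x} w       zero    = x
vertex         (r ∷ w) (suc i) = vertex w i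

vertex-last : (w : LWalk R k x y) → vertex w (fromℕ k) ≡ y
vertex-last []      = refl
vertex-last (r ∷ w) = vertex-last w

vertex-linked : (w : LWalk R k x y) → Linked R k (vertex w)
vertex-linked (r ∷ w) zero    = r
vertex-linked (r ∷ w) (suc i) = vertex-linked w i

fromLWalk : LWalk R k x y → Walk R x y
fromLWalk {k = k} w = record
  { len = k ; vtx = vertex w ; start = refl ; end = vertex-last w ; steps = vertex-linked w }

skipLoop : ∀ {L} f → Linked R L f → ∀ i j → f i ≡ f j →
           LWalk R (toℕ i + (L ∸ toℕ j)) (f zero) (f (fromℕ L))
skipLoop {R = R} {L = L} f s i j fi≡fj =
  prefixᶠ f s i ++ subst (λ z → LWalk R _ z (f (fromℕ L))) (sym fi≡fj) (suffixᶠ f s j)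

geodesic⇒path : (w : LWalk R m x y) → ≤Dist R m x y → Path R x y
geodesic⇒path {R = R} {m = m} w geodesic = record { walk = fromLWalk w ; simple = injective }
  where
  noLoop : ∀ i j → toℕ i < toℕ j → vertex w i ≢ vertex w j
  noLoop i j i<j loop = <⇒≱ shorter
    (geodesic (subst (LWalk R _ _) (vertex-last w) (skipLoop (vertex w) (vertex-linked w) i j loop)))
    where
    shorter : toℕ i + (m ∸ toℕ j) < m
    shorter = subst (toℕ i + (m ∸ toℕ j) <_) (m+[n∸m]≡n (s≤s⁻¹ (toℕ<n j)))
                    (+-monoˡ-< (m ∸ toℕ j) i<j)
  injective : ∀ {i j} → vertex w i ≡ vertex w j → i ≡ j
  injective {i} {j} eq with <-cmp (toℕ i) (toℕ j)
  ... | tri< i<j _ _ = ⊥-elim (noLoop i j i<j eq)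
  ... | tri≈ _ i≡j _ = toℕ-injective i≡j
  ... | tri> _ _ j<i = ⊥-elim (noLoop j i j<i (sym eq))

shortest⇒≤Dist : Decidable R → (q : Path R x y) → Shortest q → ≤Dist R (plen q) x y
shortest⇒≤Dist {x = x} {y = y} R? q shortest w
  with least (λ k → lwalk? R? k x y) w
... | m , geodesic , minimal = ≤-trans (shortest (geodesic⇒path geodesic minimal)) (minimal w)

traverses? : (κ : Kind) (a b : Fin n) → Decidable (Traverses κ a b)
traverses? undirected a b x y = ((x ≟ a) ×-dec (y ≟ b)) ⊎-dec ((x ≟ b) ×-dec (y ≟ a))
traverses? directed   a b x y = (x ≟ a) ×-dec (y ≟ b)

module WithoutEdge {n} (κ : Kind) (G : Graph n) (a b : Fin n) where

  E M Tr : Rel (Fin n) 0ℓ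
  E  = Edge G
  M  = Minus κ G a b
  Tr = Traverses κ a b

  E? : Decidable E
  E? x y = T? (adj G x y)

  M? : Decidable M
  M? x y = E? x y ×-dec ¬? (traverses? κ a b x y)

  data UsingWalk : ℕ → Fin n → Fin n → Set where
    here  : E x y → Tr x y → LWalk E k y z → UsingWalk (suc k) x z
    _∷ᵘ_ : E x y → UsingWalk k y z → UsingWalk (suc k) x z

  usingWalk? : ∀ k x y → Dec (UsingWalk k x y)
  usingWalk? zero    x y = no λ ()
  usingWalk? (suc k) x y
    with any? (λ z → E? x z ×-dec ((traverses? κ a b x z ×-dec lwalk? E? k z y) ⊎-dec usingWalk? k z y))
  ... | yes (z , r , inj₁ (t , w)) = yes (here r t w)
  ... | yes (z , r , inj₂ w)       = yes (r ∷ᵘ w)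
  ... | no ¬step = no λ { (here r t w) → ¬step (_ , r , inj₁ (t , w))
                        ; (r ∷ᵘ w)     → ¬step (_ , r , inj₂ w) }

  forget : UsingWalk k x y → LWalk E k x y
  forget (here e t w) = e ∷ w
  forget (r ∷ᵘ w)     = r ∷ forget w

  UsingWithin : ℕ → Fin n → Fin n → Set
  UsingWithin ℓ x y = ∃[ k ] k ≤ ℓ × UsingWalk k x y

  usingWithin? : ∀ ℓ x y → Dec (UsingWithin ℓ x y)
  usingWithin? ℓ x y = map′ (λ (k , k<1+ℓ , w) → k , s≤s⁻¹ k<1+ℓ , w)
                            (λ (k , k≤ℓ , w) → k , s≤s k≤ℓ , w)
                            (anyUpTo? (λ k → usingWalk? k x y) (suc ℓ))

  ¬UsingWithin₀ : ¬ UsingWithin 0 x y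
  ¬UsingWithin₀ (_ , z≤n , ())

  UsingGeodesic : ℕ → Fin n → Fin n → Set
  UsingGeodesic m x y = UsingWalk m x y × ≤Dist E m x y

  data Crossing (R S : Rel (Fin n) 0ℓ) : ℕ → Fin n → Fin n → Set where
    cross : ∀ {x′ y′} → LWalk R k x x′ → E x′ y′ → Tr x′ y′ → LWalk S l y′ y →
            Crossing R S (k + suc l) x y

  _∷ᶜ_ : ∀ {R S} → R x y → Crossing R S k y z → Crossing R S (suc k) x z
  r ∷ᶜ cross α e t β = cross (r ∷ α) e t β

  crossing⇒using : ∀ {S} → (∀ {x y} → S x y → E x y) → Crossing E S k x y → UsingWalk k x y
  crossing⇒using S⊆E (cross []      e t β) = here e t (map S⊆E β)
  crossing⇒using S⊆E (cross (r ∷ α) e t β) = r ∷ᵘ crossing⇒using S⊆E (cross α e t β)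

  firstCrossing : UsingWalk k x y → Crossing M E k x y
  firstCrossing (here e t w) = cross [] e t w
  firstCrossing (_∷ᵘ_ {x = x} {y = z} r w) with traverses? κ a b x z
  ... | yes t = cross [] r t (forget w)
  ... | no ¬t = (r , ¬t) ∷ᶜ firstCrossing w

  avoidOrCross : LWalk E k x y → LWalk M k x y ⊎ Crossing E M k x y
  avoidOrCross [] = inj₁ []
  avoidOrCross (_∷_ {x = x} {y = z} r w) with avoidOrCross w
  ... | inj₂ c = inj₂ (r ∷ᶜ c)
  ... | inj₁ α with traverses? κ a b x z
  ...   | yes t = inj₂ (cross [] r t α)
  ...   | no ¬t = inj₁ ((r , ¬t) ∷ α)

  lastCrossing : UsingWalk k x y → Crossing E M k x y
  lastCrossing (here e t w) with avoidOrCross w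
  ... | inj₁ α = cross [] e t α
  ... | inj₂ c = e ∷ᶜ c
  lastCrossing (r ∷ᵘ w) = r ∷ᶜ lastCrossing w

  usingWalkᶠ : ∀ {L} f → Linked E L f → (i : Fin L) → Tr (f (inject₁ i)) (f (suc i)) →
               UsingWalk L (f zero) (f (fromℕ L))
  usingWalkᶠ {L = suc L} f s zero    t = here (s zero) t (suffixᶠ (f ∘ suc) (s ∘ suc) zero)
  usingWalkᶠ {L = suc L} f s (suc i) t = s zero ∷ᵘ usingWalkᶠ (f ∘ suc) (s ∘ suc) i t

  shortest-using⇒within : (q : Path E x y) → Shortest q → LWalk E ℓ x y →
                          Uses κ a b q → UsingWithin ℓ x y
  shortest-using⇒within q shortest w (i , t) =
    plen q , shortest⇒≤Dist E? q shortest w ,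
    subst₂ (UsingWalk (plen q)) (start (walk q)) (end (walk q))
           (usingWalkᶠ (pvtx q) (steps (walk q)) i t)

  -- A geodesic shorter than ℓ must use e, since G' has no walk that short.
  within⇒geodesic : UsingWithin ℓ x y → ≤Dist M ℓ x y → ∃[ m ] m ≤ ℓ × UsingGeodesic m x y
  within⇒geodesic {ℓ = ℓ} {x = x} {y = y} (k , k≤ℓ , w) ℓ≤M
    with least (λ k → lwalk? E? k x y) (forget w)
  ... | m , geodesic , minimal with ℓ ≤? m
  ...   | yes ℓ≤m = k , k≤ℓ , w , λ w′ → ≤-trans k≤ℓ (≤-trans ℓ≤m (minimal w′))
  ...   | no ℓ≰m with avoidOrCross geodesic
  ...     | inj₁ α = ⊥-elim (ℓ≰m (ℓ≤M α))
  ...     | inj₂ c = m , ≰⇒≥ ℓ≰m , crossing⇒using proj₁ c , minimal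

  NoDoubleCrossing : Set
  NoDoubleCrossing = ∀ {m₁ m₂ u w v} → UsingGeodesic m₁ u w → UsingGeodesic m₂ w v →
                     ¬ ≤Dist M (m₁ + m₂) u v

  module Along {u v} (p : Path M u v) (p-shortest : Shortest p) where

    d : ℕ
    d = plen p

    f : Fin (suc d) → Fin n
    f = pvtx p

    p-prefix : (j : Fin (suc d)) → LWalk M (toℕ j) u (f j)
    p-prefix = prefix (walk p)

    p-suffix : (j : Fin (suc d)) → LWalk M (d ∸ toℕ j) (f j) v
    p-suffix = suffix (walk p)

    p-geodesic : ≤Dist M d u v
    p-geodesic = shortest⇒≤Dist M? p p-shortest

    j≤d : (j : Fin (suc d)) → toℕ j ≤ d
    j≤d j = s≤s⁻¹ (toℕ<n j)

    before-bound : (j : Fin (suc d)) → ≤Dist M (toℕ j) u (f j)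
    before-bound j {k} α = subst (_≤ k) (m∸[m∸n]≡n (j≤d j))
      (m≤n+o⇒m∸n≤o d (d ∸ toℕ j) (subst (d ≤_) (+-comm k _) (p-geodesic (α ++ p-suffix j))))

    after-bound : (j : Fin (suc d)) → ≤Dist M (d ∸ toℕ j) (f j) v
    after-bound j β = m≤n+o⇒m∸n≤o d (toℕ j) (p-geodesic (p-prefix j ++ β))

    -- Bounded rather than shortest walks keep these decidable; within⇒geodesic recovers geodesics.
    UsingIn UsingOut : Fin (suc d) → Set
    UsingIn  j = UsingWithin (toℕ j) u (f j)
    UsingOut j = UsingWithin (d ∸ toℕ j) (f j) v

    in-out-disjoint : NoDoubleCrossing → ∀ j → UsingIn j → UsingOut j → ⊥
    in-out-disjoint noDouble j into out
      with within⇒geodesic into (before-bound j) | within⇒geodesic out (after-bound j)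
    ... | m₁ , m₁≤j , g₁ | m₂ , m₂≤d-j , g₂ = noDouble g₁ g₂ λ γ → ≤-trans m₁+m₂≤d (p-geodesic γ)
      where
      m₁+m₂≤d : m₁ + m₂ ≤ d
      m₁+m₂≤d = subst (m₁ + m₂ ≤_) (m+[n∸m]≡n (j≤d j)) (+-mono-≤ m₁≤j m₂≤d-j)

    ¬UsingOut-end : ¬ UsingOut (fromℕ d)
    ¬UsingOut-end = ¬UsingWithin₀ ∘ subst (λ ℓ → UsingWithin ℓ (f (fromℕ d)) v)
                                         (trans (cong (d ∸_) (toℕ-fromℕ d)) (n∸n≡0 d))

    crossover-index : NoDoubleCrossing → u ≢ v → ∃[ i ] ¬ UsingIn (inject₁ i) × ¬ UsingOut (suc i)
    crossover-index noDouble u≢v =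
      crossover UsingIn UsingOut (λ j → usingWithin? _ _ _) ¬UsingWithin₀ ¬UsingOut-end
                (in-out-disjoint noDouble) (distinct⇒len≢0 u≢v (walk p))

acyclic⇒noCycle : {G : Graph n} → Acyclic G → ¬ LWalk (Edge G) (suc k) x x
acyclic⇒noCycle acyclic c = 1+n≢0 (acyclic _ (fromLWalk c))

acyclic⇒noDoubleCrossing : {G : Graph n} {a b : Fin n} → Acyclic G →
                           WithoutEdge.NoDoubleCrossing directed G a b
acyclic⇒noDoubleCrossing {G = G} {a} {b} acyclic (w₁ , _) (w₂ , _) _ =
  cycle (firstCrossing w₁) (firstCrossing w₂)
  where
  open WithoutEdge directed G a b
  cycle : ∀ {u w v} → Crossing M E k u w → Crossing M E l w v → ⊥
  cycle (cross _ e (refl , refl) β₁) (cross α₂ _ (refl , refl) _) =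
    acyclic⇒noCycle acyclic (e ∷ β₁ ++ map proj₁ α₂)

same-or-opposite : {a b x y x′ y′ : Fin n} →
                 Traverses undirected a b x y → Traverses undirected a b x′ y′ →
                 (x′ ≡ x × y′ ≡ y) ⊎ (x′ ≡ y × y′ ≡ x)
same-or-opposite (inj₁ (refl , refl)) (inj₁ (refl , refl)) = inj₁ (refl , refl)
same-or-opposite (inj₁ (refl , refl)) (inj₂ (refl , refl)) = inj₂ (refl , refl)
same-or-opposite (inj₂ (refl , refl)) (inj₁ (refl , refl)) = inj₂ (refl , refl)
same-or-opposite (inj₂ (refl , refl)) (inj₂ (refl , refl)) = inj₁ (refl , refl)

undirected⇒noDoubleCrossing : {G : Graph n} {a b : Fin n} → Undirected G →
                              WithoutEdge.NoDoubleCrossing undirected G a b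
undirected⇒noDoubleCrossing {G = G} {a} {b} undirectedG (w₁ , g₁) (w₂ , g₂) =
  split (firstCrossing w₁) (lastCrossing w₂) g₁ g₂
  where
  open WithoutEdge undirected G a b
  symE : Symmetric E
  symE {x} {y} = subst T (undirectedG x y)
  split : ∀ {m₁ m₂ u w v} → Crossing M E m₁ u w → Crossing E M m₂ w v →
          ≤Dist E m₁ u w → ≤Dist E m₂ w v → ¬ ≤Dist M (m₁ + m₂) u v
  split (cross {k₁} {l = k₂} α₁ _ t₁ β₁) (cross {k₃} {l = k₄} α₂ _ t₂ β₂) g₁ g₂ short
    with same-or-opposite t₁ t₂
  ... | inj₁ (refl , refl) = <-asym k₂<k₃ k₃<k₂
    where
    k₂<k₃ : k₂ < k₃
    k₂<k₃ = +-cancelˡ-≤ k₁ _ _ (g₁ (map proj₁ α₁ ++ reverse symE α₂))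
    k₃<k₂ : k₃ < k₂
    k₃<k₂ = +-cancelʳ-≤ k₄ _ _
      (subst (_≤ k₂ + k₄) (+-suc k₃ k₄) (g₂ (reverse symE β₁ ++ map proj₁ β₂)))
  ... | inj₂ (refl , refl) =
    <⇒≱ (+-mono-≤-< (m≤m+n k₁ (suc k₂)) (m≤n+m (suc k₄) k₃)) (short (α₁ ++ β₂))

noDoubleCrossing : (κ : Kind) {G : Graph n} {a b : Fin n} → GraphOfKind κ G →
                   WithoutEdge.NoDoubleCrossing κ G a b
noDoubleCrossing undirected = undirected⇒noDoubleCrossing
noDoubleCrossing directed   = acyclic⇒noDoubleCrossing

lemma7 : ∀ {n : ℕ} (k : Kind) (G : Graph n) → GraphOfKind k G →
         (a b : Fin n) → Edge G a b →
         (u v : Fin n) → u ≢ v →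
         Path (Minus k G a b) u v →
         (p : Path (Minus k G a b) u v) → Shortest p →
         ∃[ i ] (((q : Path (Edge G) u (pvtx p (inject₁ i))) → Shortest q → ¬ Uses k a b q)
               × ((q : Path (Edge G) (pvtx p (suc i)) v) → Shortest q → ¬ Uses k a b q))
lemma7 κ G ofKind a b _ u v u≢v _ p p-shortest =
  let (i , ¬into , ¬out) = crossover-index (noDoubleCrossing κ ofKind) u≢v in
  i , (λ q q-shortest → ¬into ∘ shortest-using⇒within q q-shortest (map proj₁ (p-prefix (inject₁ i))))
    , (λ q q-shortest → ¬out  ∘ shortest-using⇒within q q-shortest (map proj₁ (p-suffix (suc i))))
  where
  open WithoutEdge κ G a b
  open Along p p-shortest
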